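{- Let $G=(V,E)$ be a connected finite simple graph, let $B\subseteq E$ be its set of bridges, and let $S\subseteq V$ be the set of isolated vertices of $G-B$. If $G$ contains a $\mathrm{PHC}_3$, then the degree $d_G(v)$ is odd for every $v\in S$.
   Context: A bridge is an edge whose removal disconnects the graph. A closed walk is a sequence $v_0e_1v_1\cdots e_\ell v_\ell$ with $e_i=\{v_{i-1},v_i\}\in E$ and $v_\ell=v_0$; vertices and edges may be repeated. The visit number of a vertex $v$ is the number of indices $i\in\{1,\dots,\ell\}$ with $v_i=v$. A parity Hamiltonian cycle (PHC) is a closed walk in which every vertex has odd visit number; a $\mathrm{PHC}_3$ is a PHC using each edge at most $3$ times. -}

module Defs where

open import Data.Bool using (Bool; true; false; T; _∧_; _∨_; not; if_then_else_)
open import Data.Nat using (ℕ; zero; suc; _≤_; _%_)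
open import Data.Fin using (Fin; _≟_)
open import Data.List using (List; []; _∷_; allFin)
import Data.List
import Data.Maybe
open import Data.List.Relation.Unary.Linked using (Linked)
open import Data.Product using (_×_; Σ; ∃)
open import Relation.Nullary using (¬_)
open import Relation.Nullary.Decidable using (⌊_⌋)
open import Relation.Binary.PropositionalEquality using (_≡_)

-- A finite simple graph on vertex set Fin n, given by a symmetric,
-- irreflexive Boolean adjacency relation.  The edge set E is the set
-- of unordered pairs {u,v} with adj u v ≡ true.
record SimpleGraph (n : ℕ) : Set where
  field
    adj    : Fin n → Fin n → Bool
    sym    : ∀ u v → adj u v ≡ adj v u
    irrefl : ∀ v → adj v v ≡ false
open SimpleGraph public

countB : {A : Set} → (A → Bool) → List A → ℕ
countB p []       = 0
countB p (x ∷ xs) = if p x then suc (countB p xs) else countB p xs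

_==_ : {n : ℕ} → Fin n → Fin n → Bool
u == v = ⌊ u ≟ v ⌋

degree : {n : ℕ} → SimpleGraph n → Fin n → ℕ
degree {n} G v = countB (λ u → adj G v u) (allFin n)

data Walk {n : ℕ} (R : Fin n → Fin n → Bool) : Fin n → Fin n → Set where
  stay : ∀ {u} → Walk R u u
  step : ∀ {u w v} → T (R u w) → Walk R w v → Walk R u v

ConnectedRel : {n : ℕ} → (Fin n → Fin n → Bool) → Set
ConnectedRel {n} R = ∀ (u v : Fin n) → Walk R u v

Connected : {n : ℕ} → SimpleGraph n → Set
Connected G = ConnectedRel (adj G)

sameEdge : {n : ℕ} → Fin n → Fin n → Fin n → Fin n → Bool
sameEdge a b x y = ((x == a) ∧ (y == b)) ∨ ((x == b) ∧ (y == a))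

deleteEdge : {n : ℕ} → SimpleGraph n → Fin n → Fin n → Fin n → Fin n → Bool
deleteEdge G a b x y = adj G x y ∧ not (sameEdge a b x y)

IsBridge : {n : ℕ} → SimpleGraph n → Fin n → Fin n → Set
IsBridge G a b = T (adj G a b) × ¬ ConnectedRel (deleteEdge G a b)

IsolatedAfterBridgeRemoval : {n : ℕ} → SimpleGraph n → Fin n → Set
IsolatedAfterBridgeRemoval G v = ∀ u → T (adj G v u) → IsBridge G v u

-- Closed walk v0 e1 v1 ... e_l v_l (v_l = v0), represented by its vertex
-- sequence v0 ∷ vs with vs = [v1, ..., v_l]; consecutive vertices adjacent.
record ClosedWalk {n : ℕ} (G : SimpleGraph n) : Set where
  field
    start  : Fin n
    rest   : List (Fin n)
    linked : Linked (λ x y → T (adj G x y)) (start ∷ rest)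
    closed : Data.List.last (start ∷ rest) ≡ Data.Maybe.just start
open ClosedWalk public

-- visit number: number of i ∈ {1..l} with v_i = v
visits : {n : ℕ} {G : SimpleGraph n} → ClosedWalk G → Fin n → ℕ
visits W v = countB (λ x → x == v) (rest W)

edgeUsesList : {n : ℕ} → Fin n → Fin n → List (Fin n) → ℕ
edgeUsesList a b []           = 0
edgeUsesList a b (x ∷ [])     = 0
edgeUsesList a b (x ∷ y ∷ xs) =
  if sameEdge a b x y then suc (edgeUsesList a b (y ∷ xs)) else edgeUsesList a b (y ∷ xs)

edgeUses : {n : ℕ} {G : SimpleGraph n} → ClosedWalk G → Fin n → Fin n → ℕ
edgeUses W a b = edgeUsesList a b (start W ∷ rest W)

Odd : ℕ → Set
Odd m = m % 2 ≡ 1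

IsPHC : {n : ℕ} {G : SimpleGraph n} → ClosedWalk G → Set
IsPHC {n} W = ∀ (v : Fin n) → Odd (visits W v)

IsPHC3 : {n : ℕ} {G : SimpleGraph n} → ClosedWalk G → Set
IsPHC3 {n} {G} W = IsPHC W × (∀ (a b : Fin n) → T (adj G a b) → edgeUses W a b ≤ 3)

HasPHC3 : {n : ℕ} → SimpleGraph n → Set
HasPHC3 G = Σ (ClosedWalk G) IsPHC3

module Submission where

-- A closed walk crosses every cut of the graph an even number of times.  If every edge
-- vu at v is a bridge, the cut separating the two sides of G − vu is crossed only
-- through vu, and it is crossed at least once because a PHC visits every vertex; using
-- vu at most three times, the walk therefore uses it exactly twice.  Counting the steps
-- of the walk at v, twice the visit number of v equals the total number of uses of the
-- edges at v, which is 2·d(v); hence d(v) is the visit number, which is odd.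

open import Defs hiding (sym)
import Data.Nat.Properties as ℕ
open import Algebra.Properties.CommutativeSemigroup ℕ.+-commutativeSemigroup using (interchange)
open import Algebra.Properties.Semiring.Sum ℕ.+-*-semiring
  using (sum-syntax; sum-cong-≗; ∑-distrib-+; *-distribˡ-sum; sum-replicate-zero)
open import Data.Bool using (Bool; true; false; T; _∧_; _∨_; _xor_; not; if_then_else_)
open import Data.Bool.Properties
  using (∧-zeroʳ; ∧-identityʳ; ∨-identityʳ; ∧-comm; ∨-comm; xor-comm; xor-same;
         T-∧; T-∨; T-≡; T-not-≡; ⇔→≡)
open import Data.Empty using (⊥-elim)
open import Data.Fin using (Fin; zero; suc; _≟_)
open import Data.List using (List; []; _∷_; tabulate; last)
open import Data.List.Membership.Propositional using (_∈_)
open import Data.List.Relation.Unary.Any using (here; there)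
open import Data.List.Relation.Unary.Linked using (Linked; []; [-]; _∷_)
open import Data.Maybe using (just)
open import Data.Nat using (ℕ; zero; suc; _+_; _*_; _≤_; _%_; s≤s)
open import Data.Nat.DivMod using ([m+kn]%n≡m%n; m*n%n≡0)
open import Data.Nat.Properties
  using (+-comm; +-assoc; +-identityʳ; *-comm; *-identityʳ; *-zeroʳ; *-distribʳ-+;
         +-cancelʳ-≡; *-cancelˡ-≡; m+n≡0⇒m≡0; m+n≡0⇒n≡0)
open import Data.Product using (_×_; _,_; proj₂)
open import Data.Sum as Sum using (_⊎_; inj₁; inj₂)
open import Function.Bundles using (Equivalence; mk⇔)
open import Relation.Nullary using (¬_; Dec; yes; no; ¬¬-excluded-middle; decidable-stable)
open import Relation.Nullary.Decidable using (⌊_⌋; toWitness; fromWitness; fromWitnessFalse)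
open import Relation.Binary.PropositionalEquality

bit : Bool → ℕ
bit true  = 1
bit false = 0

bit-if : ∀ b k → (if b then suc k else k) ≡ bit b + k
bit-if true  k = refl
bit-if false k = refl

bit≡0⇒false : ∀ {b} → bit b ≡ 0 → b ≡ false
bit≡0⇒false {false} _ = refl

bit-+ : ∀ a b → bit a + bit b ≡ bit (a xor b) + bit (a ∧ b) * 2
bit-+ true  true  = refl
bit-+ true  false = refl
bit-+ false true  = refl
bit-+ false false = refl

m*bit≢0⇒≡m : ∀ m b → ¬ m * bit b ≡ 0 → m * bit b ≡ m
m*bit≢0⇒≡m m true  _   = *-identityʳ m
m*bit≢0⇒≡m m false ≢0 = ⊥-elim (≢0 (*-zeroʳ m))

xor≡false⇒≡ : ∀ a b → a xor b ≡ false → a ≡ b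
xor≡false⇒≡ true  true  _ = refl
xor≡false⇒≡ false false _ = refl

countB-tabulate : ∀ {A : Set} {n} (p : A → Bool) (g : Fin n → A) →
                  countB p (tabulate g) ≡ ∑[ i < n ] bit (p (g i))
countB-tabulate {n = zero}  p g = refl
countB-tabulate {n = suc n} p g =
  trans (bit-if (p (g zero)) _) (cong (bit (p (g zero)) +_) (countB-tabulate p (λ i → g (suc i))))

==-suc : ∀ {n} (x y : Fin n) → _==_ {suc n} (suc x) (suc y) ≡ x == y
==-suc x y with x ≟ y
... | yes _ = refl
... | no _  = refl

∑-== : ∀ {n} (y : Fin n) → ∑[ u < n ] bit (y == u) ≡ 1
∑-== {suc n} zero    = cong suc (sum-replicate-zero n)
∑-== {suc n} (suc y) = trans (sum-cong-≗ (λ u → cong bit (==-suc y u))) (∑-== y)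

countB-==≢0⇒∈ : ∀ {n} {z : Fin n} xs → ¬ countB (_== z) xs ≡ 0 → z ∈ xs
countB-==≢0⇒∈         []       none = ⊥-elim (none refl)
countB-==≢0⇒∈ {z = z} (x ∷ xs) none with x ≟ z
... | yes refl = here refl
... | no _     = there (countB-==≢0⇒∈ xs none)

even-nonzero-≤3⇒≡2 : ∀ {m} k l → m + k * 2 ≡ l * 2 → ¬ m ≡ 0 → m ≤ 3 → m ≡ 2
even-nonzero-≤3⇒≡2 {m} k l even = cases m m%2≡0
  where
  m%2≡0 : m % 2 ≡ 0
  m%2≡0 = trans (sym ([m+kn]%n≡m%n m k 2)) (trans (cong (_% 2) even) (m*n%n≡0 l 2))
  cases : ∀ m → m % 2 ≡ 0 → ¬ m ≡ 0 → m ≤ 3 → m ≡ 2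
  cases 0 _ m≢0 _ = ⊥-elim (m≢0 refl)
  cases 2 _ _   _ = refl
  cases (suc (suc (suc (suc _)))) _ _ (s≤s (s≤s (s≤s ())))

¬¬-decide : ∀ {n} (P : Fin n → Set) → ¬ ¬ (∀ x → Dec (P x))
¬¬-decide {zero}  P k = k (λ ())
¬¬-decide {suc n} P k =
  ¬¬-excluded-middle λ P0? → ¬¬-decide (λ x → P (suc x)) λ P? →
    k λ { zero → P0? ; (suc x) → P? x }

stepSum : ∀ {A : Set} → (A → A → ℕ) → List A → ℕ
stepSum g []           = 0
stepSum g (x ∷ [])     = 0
stepSum g (x ∷ y ∷ xs) = g x y + stepSum g (y ∷ xs)

module _ {A : Set} where

  stepSum-cong : ∀ {R : A → A → Set} {g h : A → A → ℕ} {xs} → Linked R xs →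
                 (∀ {x y} → R x y → g x y ≡ h x y) → stepSum g xs ≡ stepSum h xs
  stepSum-cong []           g≡h = refl
  stepSum-cong [-]          g≡h = refl
  stepSum-cong (Rxy ∷ path) g≡h = cong₂ _+_ (g≡h Rxy) (stepSum-cong path g≡h)

  stepSum-cong-≗ : ∀ {g h : A → A → ℕ} → (∀ x y → g x y ≡ h x y) →
                   ∀ xs → stepSum g xs ≡ stepSum h xs
  stepSum-cong-≗ g≗h []           = refl
  stepSum-cong-≗ g≗h (x ∷ [])     = refl
  stepSum-cong-≗ g≗h (x ∷ y ∷ xs) = cong₂ _+_ (g≗h x y) (stepSum-cong-≗ g≗h (y ∷ xs))

  stepSum-0 : ∀ (xs : List A) → stepSum (λ _ _ → 0) xs ≡ 0
  stepSum-0 []           = refl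
  stepSum-0 (x ∷ [])     = refl
  stepSum-0 (x ∷ y ∷ xs) = stepSum-0 (y ∷ xs)

  stepSum-+ : ∀ (g h : A → A → ℕ) xs →
              stepSum (λ x y → g x y + h x y) xs ≡ stepSum g xs + stepSum h xs
  stepSum-+ g h []           = refl
  stepSum-+ g h (x ∷ [])     = refl
  stepSum-+ g h (x ∷ y ∷ xs) =
    trans (cong (g x y + h x y +_) (stepSum-+ g h (y ∷ xs))) (interchange (g x y) (h x y) _ _)

  stepSum-*ʳ : ∀ (g : A → A → ℕ) c xs → stepSum (λ x y → g x y * c) xs ≡ stepSum g xs * c
  stepSum-*ʳ g c []           = refl
  stepSum-*ʳ g c (x ∷ [])     = refl
  stepSum-*ʳ g c (x ∷ y ∷ xs) =
    trans (cong (g x y * c +_) (stepSum-*ʳ g c (y ∷ xs))) (sym (*-distribʳ-+ c (g x y) _))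

  ∑-stepSum : ∀ {n} (g : Fin n → A → A → ℕ) xs →
              ∑[ u < n ] stepSum (g u) xs ≡ stepSum (λ x y → ∑[ u < n ] g u x y) xs
  ∑-stepSum {n} g []           = sum-replicate-zero n
  ∑-stepSum {n} g (x ∷ [])     = sum-replicate-zero n
  ∑-stepSum     g (x ∷ y ∷ xs) =
    trans (∑-distrib-+ (λ u → g u x y) _) (cong (_ +_) (∑-stepSum g (y ∷ xs)))

  stepSum-target : ∀ (p : A → Bool) x xs →
                   stepSum (λ _ y → bit (p y)) (x ∷ xs) ≡ countB p xs
  stepSum-target p x []       = refl
  stepSum-target p x (y ∷ xs) =
    trans (cong (bit (p y) +_) (stepSum-target p y xs)) (sym (bit-if (p y) _))

  stepSum-source+last : ∀ (p : A → Bool) x xs {z} → last (x ∷ xs) ≡ just z →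
                        stepSum (λ y _ → bit (p y)) (x ∷ xs) + bit (p z) ≡ bit (p x) + countB p xs
  stepSum-source+last p x []       refl = +-comm 0 (bit (p x))
  stepSum-source+last p x (y ∷ xs) eq = begin
    bit (p x) + stepSum source (y ∷ xs) + _   ≡⟨ +-assoc (bit (p x)) _ _ ⟩
    bit (p x) + (stepSum source (y ∷ xs) + _) ≡⟨ cong (bit (p x) +_) (stepSum-source+last p y xs eq) ⟩
    bit (p x) + (bit (p y) + countB p xs)     ≡⟨ cong (bit (p x) +_) (bit-if (p y) _) ⟨
    bit (p x) + countB p (y ∷ xs)             ∎
    where
    open ≡-Reasoning
    source : A → A → ℕ
    source a _ = bit (p a)

  stepSum-source : ∀ (p : A → Bool) x xs → last (x ∷ xs) ≡ just x →
                   stepSum (λ y _ → bit (p y)) (x ∷ xs) ≡ countB p xs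
  stepSum-source p x xs closed =
    +-cancelʳ-≡ (bit (p x)) _ _ (trans (stepSum-source+last p x xs closed) (+-comm (bit (p x)) _))

  -- The number of steps of a closed walk crossing a 2-colouring f is even: add up
  -- bit (f a) + bit (f b) over the steps in two ways.
  stepSum-xor-even : ∀ (f : A → Bool) x xs → last (x ∷ xs) ≡ just x →
                     stepSum (λ a b → bit (f a xor f b)) (x ∷ xs)
                       + stepSum (λ a b → bit (f a ∧ f b)) (x ∷ xs) * 2
                     ≡ countB f xs * 2
  stepSum-xor-even f x xs closed = begin
    stepSum cross walk + stepSum both walk * 2
      ≡⟨ cong (stepSum cross walk +_) (stepSum-*ʳ both 2 walk) ⟨
    stepSum cross walk + stepSum (λ a b → both a b * 2) walk
      ≡⟨ stepSum-+ cross (λ a b → both a b * 2) walk ⟨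
    stepSum (λ a b → cross a b + both a b * 2) walk
      ≡⟨ stepSum-cong-≗ (λ a b → bit-+ (f a) (f b)) walk ⟨
    stepSum (λ a b → bit (f a) + bit (f b)) walk
      ≡⟨ stepSum-+ (λ a _ → bit (f a)) (λ _ b → bit (f b)) walk ⟩
    stepSum (λ a _ → bit (f a)) walk + stepSum (λ _ b → bit (f b)) walk
      ≡⟨ cong₂ _+_ (stepSum-source f x xs closed) (stepSum-target f x xs) ⟩
    countB f xs + countB f xs
      ≡⟨ cong (countB f xs +_) (+-identityʳ (countB f xs)) ⟨
    2 * countB f xs
      ≡⟨ *-comm 2 (countB f xs) ⟩
    countB f xs * 2 ∎
    where
    open ≡-Reasoning
    walk = x ∷ xs
    cross both : A → A → ℕ
    cross a b = bit (f a xor f b)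
    both a b = bit (f a ∧ f b)

  stepSum-xor≡0 : ∀ (f : A → Bool) x xs {z} →
                  stepSum (λ a b → bit (f a xor f b)) (x ∷ xs) ≡ 0 → z ∈ xs → f z ≡ f x
  stepSum-xor≡0 f x (y ∷ xs) none z∈
    with xor≡false⇒≡ (f x) (f y) (bit≡0⇒false (m+n≡0⇒m≡0 _ none))
  stepSum-xor≡0 f x (y ∷ xs) none (here refl) | fx≡fy = sym fx≡fy
  stepSum-xor≡0 f x (y ∷ xs) none (there z∈) | fx≡fy =
    trans (stepSum-xor≡0 f y xs (m+n≡0⇒n≡0 _ none) z∈) (sym fx≡fy)

edgeUsesList≡stepSum : ∀ {n} (a b : Fin n) xs →
                       edgeUsesList a b xs ≡ stepSum (λ x y → bit (sameEdge a b x y)) xs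
edgeUsesList≡stepSum a b []           = refl
edgeUsesList≡stepSum a b (x ∷ [])     = refl
edgeUsesList≡stepSum a b (x ∷ y ∷ xs) =
  trans (bit-if (sameEdge a b x y) _) (cong (_ +_) (edgeUsesList≡stepSum a b (y ∷ xs)))

sameEdge-sym : ∀ {n} (a b x y : Fin n) → sameEdge a b x y ≡ sameEdge a b y x
sameEdge-sym a b x y = begin
  ((x == a) ∧ (y == b)) ∨ ((x == b) ∧ (y == a)) ≡⟨ ∨-comm ((x == a) ∧ (y == b)) _ ⟩
  ((x == b) ∧ (y == a)) ∨ ((x == a) ∧ (y == b))
    ≡⟨ cong₂ _∨_ (∧-comm (x == b) _) (∧-comm (x == a) _) ⟩
  ((y == a) ∧ (x == b)) ∨ ((y == b) ∧ (x == a)) ∎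
  where open ≡-Reasoning

sameEdge⇒≡ : ∀ {n} {a b x y : Fin n} → T (sameEdge a b x y) →
             (x ≡ a × y ≡ b) ⊎ (x ≡ b × y ≡ a)
sameEdge⇒≡ {a = a} {b} {x} {y} t =
  Sum.map (witnesses (x ≟ a) (y ≟ b)) (witnesses (x ≟ b) (y ≟ a)) (Equivalence.to T-∨ t)
  where
  witnesses : ∀ {P Q : Set} (p? : Dec P) (q? : Dec Q) → T (⌊ p? ⌋ ∧ ⌊ q? ⌋) → P × Q
  witnesses p? q? pq =
    let (p , q) = Equivalence.to (T-∧ {⌊ p? ⌋} {⌊ q? ⌋}) pq in toWitness {a? = p?} p , toWitness {a? = q?} q

∑-sameEdge : ∀ {n} (v x y : Fin n) → ¬ x ≡ y →
             ∑[ u < n ] bit (sameEdge v u x y) ≡ bit (x == v) + bit (y == v)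
∑-sameEdge {n} v x y x≢y with x ≟ v | y ≟ v
... | yes refl | yes refl = ⊥-elim (x≢y refl)
... | yes refl | no _     = trans (sum-cong-≗ (λ u → cong bit (∨-∧false (y == u) (x == u))))
                                  (∑-== y)
  where
  ∨-∧false : ∀ a b → a ∨ (b ∧ false) ≡ a
  ∨-∧false a b = trans (cong (a ∨_) (∧-zeroʳ b)) (∨-identityʳ a)
... | no _     | yes refl = trans (sum-cong-≗ (λ u → cong bit (∧-identityʳ (x == u)))) (∑-== x)
... | no _     | no _     = trans (sum-cong-≗ (λ u → cong bit (∧-zeroʳ (x == u))))
                                  (sum-replicate-zero n)

module _ {n} {R : Fin n → Fin n → Bool} where

  walk-snoc : ∀ {a b c} → Walk R a b → T (R b c) → Walk R a c
  walk-snoc stay         Rbc = step Rbc stay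
  walk-snoc (step Raw w) Rbc = step Raw (walk-snoc w Rbc)

  walk-++ : ∀ {a b c} → Walk R a b → Walk R b c → Walk R a c
  walk-++ stay         w′ = w′
  walk-++ (step Raw w) w′ = step Raw (walk-++ w w′)

  module _ (R-sym : ∀ {x y} → T (R x y) → T (R y x)) where

    walk-reverse : ∀ {a b} → Walk R a b → Walk R b a
    walk-reverse stay         = stay
    walk-reverse (step Raw w) = walk-snoc (walk-reverse w) (R-sym Raw)

    connected-from : ∀ v → (∀ x → Walk R v x) → ConnectedRel R
    connected-from v reach a b = walk-++ (walk-reverse (reach a)) (reach b)

module _ {n} (G : SimpleGraph n) where

  adj-sym : ∀ {x y} → T (adj G x y) → T (adj G y x)
  adj-sym {x} {y} = subst T (SimpleGraph.sym G x y)

  adj⇒≢ : ∀ {x y} → T (adj G x y) → ¬ x ≡ y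
  adj⇒≢ {x} Gxx refl = subst T (irrefl G x) Gxx

  adj-sameEdge : ∀ {a b x y} → T (adj G x y) → T (sameEdge a b x y) → T (adj G a b)
  adj-sameEdge {a} {b} {x} {y} Gxy e with sameEdge⇒≡ {a = a} {b} {x} {y} e
  ... | inj₁ (refl , refl) = Gxy
  ... | inj₂ (refl , refl) = adj-sym Gxy

  deleteEdge-sym : ∀ a b {x y} → T (deleteEdge G a b x y) → T (deleteEdge G a b y x)
  deleteEdge-sym a b {x} {y} =
    subst T (cong₂ (λ e s → e ∧ not s) (SimpleGraph.sym G x y) (sameEdge-sym a b x y))

  deleteEdge-keeps : ∀ {a b x y} → T (adj G x y) → sameEdge a b x y ≡ false →
                     T (deleteEdge G a b x y)
  deleteEdge-keeps Gxy e rewrite e = Equivalence.from T-∧ (Gxy , _)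

module _ {n} {G : SimpleGraph n} (W : ClosedWalk G) where

  private
    walk : List (Fin n)
    walk = start W ∷ rest W

  ∑-edgeUses : ∀ v → ∑[ u < n ] edgeUses W v u ≡ 2 * visits W v
  ∑-edgeUses v = begin
    ∑[ u < n ] edgeUses W v u
      ≡⟨ sum-cong-≗ (λ u → edgeUsesList≡stepSum v u walk) ⟩
    ∑[ u < n ] stepSum (λ x y → bit (sameEdge v u x y)) walk
      ≡⟨ ∑-stepSum (λ u x y → bit (sameEdge v u x y)) walk ⟩
    stepSum (λ x y → ∑[ u < n ] bit (sameEdge v u x y)) walk
      ≡⟨ stepSum-cong (linked W) (λ {x} {y} Gxy → ∑-sameEdge v x y (adj⇒≢ G Gxy)) ⟩
    stepSum (λ x y → bit (x == v) + bit (y == v)) walk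
      ≡⟨ stepSum-+ (λ x _ → bit (x == v)) (λ _ y → bit (y == v)) walk ⟩
    stepSum (λ x _ → bit (x == v)) walk + stepSum (λ _ y → bit (y == v)) walk
      ≡⟨ cong₂ _+_ (stepSum-source (_== v) (start W) (rest W) (closed W))
                   (stepSum-target (_== v) (start W) (rest W)) ⟩
    visits W v + visits W v
      ≡⟨ cong (visits W v +_) (+-identityʳ (visits W v)) ⟨
    2 * visits W v ∎
    where open ≡-Reasoning

  edgeUses-nonedge : ∀ {v u} → ¬ T (adj G v u) → edgeUses W v u ≡ 0
  edgeUses-nonedge {v} {u} ¬Gvu =
    trans (edgeUsesList≡stepSum v u walk) (trans (stepSum-cong (linked W) unused) (stepSum-0 walk))
    where
    unused : ∀ {x y} → T (adj G x y) → bit (sameEdge v u x y) ≡ 0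
    unused {x} {y} Gxy with sameEdge v u x y in e
    ... | false = refl
    ... | true  = ⊥-elim (¬Gvu (adj-sameEdge G Gxy (Equivalence.from T-≡ e)))

  module _ {v u} (bridge : IsBridge G v u) (visitsAll : ∀ w → w ∈ rest W) where

    private
      R : Fin n → Fin n → Bool
      R = deleteEdge G v u

    -- Constructively the side of v in G − vu is only available as a decision of
    -- reachability, which exists under a double negation (the goal is decidable).
    module _ (reachable? : ∀ x → Dec (Walk R v x)) where

      private
        side : Fin n → Bool
        side x = ⌊ reachable? x ⌋

        crossing : Fin n → Fin n → ℕ
        crossing x y = bit (side x xor side y)

      side-step : ∀ {x y} → T (adj G x y) → sameEdge v u x y ≡ false → side x ≡ side y
      side-step {x} {y} Gxy e =
        ⇔→≡ (mk⇔ (extend Gxy e) (extend (adj-sym G Gxy) (trans (sameEdge-sym v u y x) e)))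
        where
        extend : ∀ {x y} → T (adj G x y) → sameEdge v u x y ≡ false →
                 side x ≡ true → side y ≡ true
        extend {x} {y} Gxy e sx = Equivalence.to T-≡ (fromWitness {a? = reachable? y}
          (walk-snoc (toWitness {a? = reachable? x} (Equivalence.from T-≡ sx)) (deleteEdge-keeps G Gxy e)))

      crossing-step : ∀ {x y} → T (adj G x y) →
                      crossing x y ≡ bit (sameEdge v u x y) * crossing v u
      crossing-step {x} {y} Gxy with sameEdge v u x y in e
      ... | false = cong bit (trans (cong (_xor side y) (side-step Gxy e)) (xor-same (side y)))
      ... | true with sameEdge⇒≡ {a = v} {u} {x} {y} (Equivalence.from T-≡ e)
      ...   | inj₁ (refl , refl) = sym (+-identityʳ _)
      ...   | inj₂ (refl , refl) = trans (cong bit (xor-comm (side u) (side v))) (sym (+-identityʳ _))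

      crossings≡ : stepSum crossing walk ≡ edgeUses W v u * crossing v u
      crossings≡ = begin
        stepSum crossing walk
          ≡⟨ stepSum-cong (linked W) crossing-step ⟩
        stepSum (λ x y → bit (sameEdge v u x y) * crossing v u) walk
          ≡⟨ stepSum-*ʳ (λ x y → bit (sameEdge v u x y)) (crossing v u) walk ⟩
        stepSum (λ x y → bit (sameEdge v u x y)) walk * crossing v u
          ≡⟨ cong (_* crossing v u) (edgeUsesList≡stepSum v u walk) ⟨
        edgeUses W v u * crossing v u ∎
        where open ≡-Reasoning

      crossings≢0 : ∀ {w} → ¬ Walk R v w → ¬ stepSum crossing walk ≡ 0
      crossings≢0 {w} ¬v→w none = true≢false (begin
        true          ≡⟨ Equivalence.to T-≡ (fromWitness {a? = reachable? v} stay) ⟨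
        side v        ≡⟨ stepSum-xor≡0 side (start W) (rest W) none (visitsAll v) ⟩
        side (start W) ≡⟨ stepSum-xor≡0 side (start W) (rest W) none (visitsAll w) ⟨
        side w        ≡⟨ Equivalence.to T-not-≡ (fromWitnessFalse {a? = reachable? w} ¬v→w) ⟩
        false         ∎)
        where
        open ≡-Reasoning
        true≢false : ¬ true ≡ false
        true≢false ()

      used-twice : ∀ {w} → ¬ Walk R v w → edgeUses W v u ≤ 3 → edgeUses W v u ≡ 2
      used-twice ¬v→w = even-nonzero-≤3⇒≡2 insideSteps (countB side (rest W)) even uses≢0
        where
        product≢0 : ¬ edgeUses W v u * crossing v u ≡ 0
        product≢0 none = crossings≢0 ¬v→w (trans crossings≡ none)
        crossings≡uses : stepSum crossing walk ≡ edgeUses W v u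
        crossings≡uses = trans crossings≡ (m*bit≢0⇒≡m _ (side v xor side u) product≢0)
        uses≢0 : ¬ edgeUses W v u ≡ 0
        uses≢0 none = crossings≢0 ¬v→w (trans crossings≡uses none)
        insideSteps : ℕ
        insideSteps = stepSum (λ a b → bit (side a ∧ side b)) walk
        even : edgeUses W v u + insideSteps * 2 ≡ countB side (rest W) * 2
        even = trans (cong (_+ insideSteps * 2) (sym crossings≡uses))
                     (stepSum-xor-even side (start W) (rest W) (closed W))

    bridge-used-twice : edgeUses W v u ≤ 3 → edgeUses W v u ≡ 2
    bridge-used-twice atMost3 = decidable-stable (edgeUses W v u ℕ.≟ 2) λ ¬twice →
      ¬¬-decide (Walk R v) λ reachable? →
        proj₂ bridge (connected-from (deleteEdge-sym G v u) v (reach reachable? ¬twice))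
      where
      reach : (∀ x → Dec (Walk R v x)) → ¬ edgeUses W v u ≡ 2 → ∀ x → Walk R v x
      reach reachable? ¬twice x with reachable? x
      ... | yes v→x  = v→x
      ... | no  ¬v→x = ⊥-elim (¬twice (used-twice reachable? ¬v→x atMost3))

proposition5p2 : ∀ (n : ℕ) (G : SimpleGraph n) → Connected G → HasPHC3 G →
                 ∀ (v : Fin n) → IsolatedAfterBridgeRemoval G v → Odd (degree G v)
proposition5p2 n G _ (W , phc , atMost3) v isolated = subst Odd visits≡degree (phc v)
  where
  visitsAll : ∀ w → w ∈ rest W
  visitsAll w = countB-==≢0⇒∈ (rest W) λ none → 0≢1 (trans (cong (_% 2) (sym none)) (phc w))
    where
    0≢1 : ¬ 0 ≡ 1
    0≢1 ()

  uses≡2*adj : ∀ u → edgeUses W v u ≡ 2 * bit (adj G v u)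
  uses≡2*adj u with adj G v u in e
  ... | false = edgeUses-nonedge W (subst T e)
  ... | true  = bridge-used-twice W (isolated u Gvu) visitsAll (atMost3 v u Gvu)
    where
    Gvu : T (adj G v u)
    Gvu = Equivalence.from T-≡ e

  visits≡degree : visits W v ≡ degree G v
  visits≡degree = *-cancelˡ-≡ _ _ 2 (begin
    2 * visits W v                   ≡⟨ ∑-edgeUses W v ⟨
    ∑[ u < n ] edgeUses W v u        ≡⟨ sum-cong-≗ uses≡2*adj ⟩
    ∑[ u < n ] (2 * bit (adj G v u)) ≡⟨ *-distribˡ-sum 2 (λ u → bit (adj G v u)) ⟨
    2 * (∑[ u < n ] bit (adj G v u)) ≡⟨ cong (2 *_) (countB-tabulate (adj G v) (λ u → u)) ⟨
    2 * degree G v                   ∎)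
    where open ≡-Reasoning
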